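{- Let $f:\mathfrak A\to\mathfrak B$ be a partial team map. Then the following are equivalent: (1) $f$ is a partial team isomorphism; (2) $f(X\times Y)=f(X)\times f(Y)$ for all $X,Y\in\mathrm{dom}(f)$, and for all quantifier-free formulas $\phi(v_0,\dots,v_{n-1})$ of $\mathrm{FOT}$ and all $n$-ary $X\in\mathrm{dom}(f)$, $\mathfrak A\models_X\phi$ iff $\mathfrak B\models_{f(X)}\phi$. In particular, every partial elementary team map is a partial team isomorphism.
   Context: For a structure $\mathfrak A$, $\mathcal R(\mathfrak A)=\bigcup_{n}\mathcal P(\mathfrak A^n)$; $X\times Y$ concatenates tuples; $\mathrm{Pr}_{\vec\imath}(X)=\{(a_{i_0},\dots,a_{i_{m-1}}):\vec a\in X\}$ for $\vec\imath\in n^{<\omega}$; $\Delta_{\mathfrak A}$ is the diagonal. $\mathrm{cl}(\mathcal X)$ is the least superset of $\mathcal X$ containing $\emptyset$, all $\mathfrak A^n$, $\Delta_{\mathfrak A}$, interpretations of relation symbols, graphs of function symbols, $\{c^{\mathfrak A}\}$ for constants, closed under $\cap$, $\times$, $\mathrm{Pr}_{\vec\imath}$. A partial team map is an arity-preserving partial function $\mathcal R(\mathfrak A)\to\mathcal R(\mathfrak B)$ whose domain and range are $\mathrm{cl}$-closed. A partial team isomorphism is a partial team map such that for $X,Y\in\mathrm{dom}(f)$: $X=\emptyset$ iff $f(X)=\emptyset$, $X=\mathfrak A^n$ iff $f(X)=\mathfrak B^n$; $X$ singleton iff $f(X)$ singleton; $f(X\times Y)=f(X)\times f(Y)$; $f(\mathrm{Pr}_{\vec\imath}(X))=\mathrm{Pr}_{\vec\imath}(f(X))$;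 $X\subseteq Y$ iff $f(X)\subseteq f(Y)$; $f(\Delta_{\mathfrak A})=\Delta_{\mathfrak B}$, $f(R^{\mathfrak A})=R^{\mathfrak B}$ for relation/function symbols $R$, $f(\{c^{\mathfrak A}\})=\{c^{\mathfrak B}\}$. A partial elementary team map is a partial team map commuting with $\times$ and preserving all $\mathrm{FOT}$-formulas in both directions on $\mathrm{dom}(f)$. $\mathrm{FOT}$ syntax: $\phi::=\lambda\mid\vec x\subseteq\vec y\mid{=}(\vec x)\mid{\sim}\phi\mid\phi\wedge\phi\mid\phi\,\underline\vee\,\phi\mid\exists^1x\phi\mid\forall^1x\phi$, $\lambda$ a first-order atomic formula; team semantics: $\lambda$ holds in $X$ iff at every $s\in X$; $\vec x\subseteq\vec y$ iff $X[\vec x]\subseteq X[\vec y]$; ${=}(\vec x)$ iff $|X[\vec x]|\le1$; ${\sim}\phi$ iff $X=\emptyset$ or $\phi$ fails in $X$; $\wedge,\underline\vee$ classical; $\exists^1x\phi$ iff $\phi$ holds in $X(a/x)=\{s(a/x):s\in X\}$ for some $a$, $\forall^1$ for all $a$. Quantifier-free means no $\exists^1,\forall^1$. An $n$-ary relation $X$ is identified with the team $\{\{(v_i,a_i):i<n\}:\vec a\in X\}$. -}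

module Defs where

open import Level using (Level) renaming (suc to lsuc)
open import Data.Nat using (ℕ; suc; _+_)
open import Data.Fin using (Fin; fromℕ)
open import Data.Vec using (Vec; []; _∷_; _++_; map; lookup; _∷ʳ_)
open import Data.Product using (Σ; _×_; _,_)
open import Data.Sum using (_⊎_)
open import Data.Empty using (⊥)
open import Data.Unit using (⊤)
open import Relation.Nullary using (¬_)
open import Relation.Binary.PropositionalEquality using (_≡_)
open import Axiom.ExcludedMiddle using (ExcludedMiddle) public

record Signature : Set₁ where
  field
    RelSym : Set
    relAr  : RelSym → ℕ
    FunSym : Set
    funAr  : FunSym → ℕ
    ConSym : Set

record Structure (σ : Signature) : Set₁ where
  open Signature σ
  field
    Carrier : Set
    relI    : (R : RelSym) → Vec Carrier (relAr R) → Set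
    funI    : (F : FunSym) → Vec Carrier (funAr F) → Carrier
    conI    : ConSym → Carrier

Rel : Set → ℕ → Set₁
Rel A n = Vec A n → Set

Iff : ∀ {a b} → Set a → Set b → Set _
Iff P Q = (P → Q) × (Q → P)

module _ {A : Set} where

  emptyRel : ∀ n → Rel A n
  emptyRel n _ = ⊥

  fullRel : ∀ n → Rel A n
  fullRel n _ = ⊤

  _∩_ : ∀ {n} → Rel A n → Rel A n → Rel A n
  (X ∩ Y) v = X v × Y v

  _⊗_ : ∀ {n m} → Rel A n → Rel A m → Rel A (n + m)
  _⊗_ {n} {m} X Y w = Σ (Vec A n) λ u → Σ (Vec A m) λ v → (w ≡ u ++ v) × X u × Y v

  Pr : ∀ {n m} → Vec (Fin n) m → Rel A n → Rel A m
  Pr {n} ı X w = Σ (Vec A n) λ v → X v × (w ≡ map (lookup v) ı)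

  diag : Rel A 2
  diag (a ∷ b ∷ []) = a ≡ b

  _⊆_ : ∀ {n} → Rel A n → Rel A n → Set
  X ⊆ Y = ∀ v → X v → Y v

  _≐_ : ∀ {n} → Rel A n → Rel A n → Set
  X ≐ Y = (X ⊆ Y) × (Y ⊆ X)

  IsEmpty : ∀ {n} → Rel A n → Set
  IsEmpty X = ∀ v → ¬ X v

  IsFull : ∀ {n} → Rel A n → Set
  IsFull X = ∀ v → X v

  IsSingleton : ∀ {n} → Rel A n → Set
  IsSingleton {n} X = Σ (Vec A n) λ a → ∀ v → Iff (X v) (v ≡ a)

module _ {σ : Signature} (𝔄 : Structure σ) where
  open Signature σ
  open Structure 𝔄

  Graph : (F : FunSym) → Rel Carrier (suc (funAr F))
  Graph F w = Σ (Vec Carrier (funAr F)) λ v → w ≡ v ∷ʳ funI F v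

  ConstRel : ConSym → Rel Carrier 1
  ConstRel c w = w ≡ conI c ∷ []

  record ClClosed (P : ∀ {n} → Rel Carrier n → Set₁) : Set₁ where
    field
      empty∈ : ∀ n → P (emptyRel n)
      full∈  : ∀ n → P (fullRel n)
      diag∈  : P diag
      rel∈   : ∀ R → P (relI R)
      graph∈ : ∀ F → P (Graph F)
      const∈ : ∀ c → P (ConstRel c)
      ∩∈     : ∀ {n} {X Y : Rel Carrier n} → P X → P Y → P (X ∩ Y)
      ⊗∈     : ∀ {n m} {X : Rel Carrier n} {Y : Rel Carrier m} → P X → P Y → P (X ⊗ Y)
      Pr∈    : ∀ {n m} (ı : Vec (Fin n) m) {X : Rel Carrier n} → P X → P (Pr ı X)

module _ {σ : Signature} (𝔄 𝔅 : Structure σ) where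
  private
    A = Structure.Carrier 𝔄
    B = Structure.Carrier 𝔅

  record PartialTeamMap : Set₂ where
    field
      dom      : ∀ {n} → Rel A n → Set₁
      dom-resp : ∀ {n} {X Y : Rel A n} → X ≐ Y → dom X → dom Y
      app      : ∀ {n} (X : Rel A n) → dom X → Rel B n
      -- well-definedness as a function on subsets (extensional equality)
      app-resp : ∀ {n} {X Y : Rel A n} → X ≐ Y → (p : dom X) (q : dom Y) → app X p ≐ app Y q

    ran : ∀ {n} → Rel B n → Set₁
    ran {n} Z = Σ (Rel A n) λ X → Σ (dom X) λ p → app X p ≐ Z

    field
      dom-closed : ClClosed 𝔄 dom
      ran-closed : ClClosed 𝔅 ran

module _ {σ : Signature} {𝔄 𝔅 : Structure σ} (f : PartialTeamMap 𝔄 𝔅) where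
  open Signature σ
  open PartialTeamMap f
  private
    module 𝔄 = Structure 𝔄
    module 𝔅 = Structure 𝔅
    A = 𝔄.Carrier

  PreservesProducts : Set₁
  PreservesProducts = ∀ {n m} {X : Rel A n} {Y : Rel A m}
    (p : dom X) (q : dom Y) (r : dom (X ⊗ Y)) → app (X ⊗ Y) r ≐ (app X p ⊗ app Y q)

  record IsPartialTeamIso : Set₁ where
    field
      empty-iff     : ∀ {n} {X : Rel A n} (p : dom X) → Iff (IsEmpty X) (IsEmpty (app X p))
      full-iff      : ∀ {n} {X : Rel A n} (p : dom X) → Iff (IsFull X) (IsFull (app X p))
      singleton-iff : ∀ {n} {X : Rel A n} (p : dom X) → Iff (IsSingleton X) (IsSingleton (app X p))
      pres-⊗        : PreservesProducts
      pres-Pr       : ∀ {n m} (ı : Vec (Fin n) m) {X : Rel A n}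
                      (p : dom X) (r : dom (Pr ı X)) → app (Pr ı X) r ≐ Pr ı (app X p)
      ⊆-iff         : ∀ {n} {X Y : Rel A n} (p : dom X) (q : dom Y) → Iff (X ⊆ Y) (app X p ⊆ app Y q)
      pres-diag     : (r : dom diag) → app diag r ≐ diag
      pres-rel      : ∀ R (r : dom (𝔄.relI R)) → app (𝔄.relI R) r ≐ 𝔅.relI R
      pres-graph    : ∀ F (r : dom (Graph 𝔄 F)) → app (Graph 𝔄 F) r ≐ Graph 𝔅 F
      pres-const    : ∀ c (r : dom (ConstRel 𝔄 c)) → app (ConstRel 𝔄 c) r ≐ ConstRel 𝔅 c

-- FOT syntax. Formulas of Formula n have free variables among v_0..v_{n-1};
-- a quantifier binds the fresh variable v_n.

module _ (σ : Signature) where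
  open Signature σ

  data Term (n : ℕ) : Set where
    var : Fin n → Term n
    con : ConSym → Term n
    fapp : (F : FunSym) → Vec (Term n) (funAr F) → Term n

  data Atomic (n : ℕ) : Set where
    _≈_ : Term n → Term n → Atomic n
    rel : (R : RelSym) → Vec (Term n) (relAr R) → Atomic n

  data Formula : ℕ → Set where
    atom  : ∀ {n} → Atomic n → Formula n
    incl  : ∀ {n k} → Vec (Fin n) k → Vec (Fin n) k → Formula n
    dep   : ∀ {n k} → Vec (Fin n) k → Formula n
    ∼_    : ∀ {n} → Formula n → Formula n
    _∧_   : ∀ {n} → Formula n → Formula n → Formula n
    _∨_   : ∀ {n} → Formula n → Formula n → Formula n
    ∃¹    : ∀ {n} → Formula (suc n) → Formula n
    ∀¹    : ∀ {n} → Formula (suc n) → Formula n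

  data QuantifierFree : ∀ {n} → Formula n → Set where
    atom : ∀ {n} (a : Atomic n) → QuantifierFree (atom a)
    incl : ∀ {n k} (x y : Vec (Fin n) k) → QuantifierFree (incl x y)
    dep  : ∀ {n k} (x : Vec (Fin n) k) → QuantifierFree (dep x)
    ∼_   : ∀ {n} {φ : Formula n} → QuantifierFree φ → QuantifierFree (∼ φ)
    _∧_  : ∀ {n} {φ ψ : Formula n} → QuantifierFree φ → QuantifierFree ψ → QuantifierFree (φ ∧ ψ)
    _∨_  : ∀ {n} {φ ψ : Formula n} → QuantifierFree φ → QuantifierFree ψ → QuantifierFree (φ ∨ ψ)

-- Team semantics: an n-ary relation X is the team over v_0..v_{n-1}

module _ {σ : Signature} (𝔄 : Structure σ) where
  open Signature σ
  open Structure 𝔄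

  mutual
    evalTerm : ∀ {n} → Vec Carrier n → Term σ n → Carrier
    evalTerm s (var i)   = lookup s i
    evalTerm s (con c)   = conI c
    evalTerm s (fapp F ts) = funI F (evalTerms s ts)

    evalTerms : ∀ {n k} → Vec Carrier n → Vec (Term σ n) k → Vec Carrier k
    evalTerms s []       = []
    evalTerms s (t ∷ ts) = evalTerm s t ∷ evalTerms s ts

  holdsAt : ∀ {n} → Atomic σ n → Vec Carrier n → Set
  holdsAt (t ≈ u)    s = evalTerm s t ≡ evalTerm s u
  holdsAt (rel R ts) s = relI R (evalTerms s ts)

  extend : ∀ {n} → Rel Carrier n → Carrier → Rel Carrier (suc n)
  extend {n} X a w = Σ (Vec Carrier n) λ s → X s × (w ≡ s ∷ʳ a)

  _⊨_ : ∀ {n} → Rel Carrier n → Formula σ n → Set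
  X ⊨ (atom λ′) = ∀ s → X s → holdsAt λ′ s
  X ⊨ (incl x y) = ∀ s → X s → Σ (Vec Carrier _) λ t → X t × (map (lookup s) x ≡ map (lookup t) y)
  X ⊨ (dep x) = ∀ s t → X s → X t → map (lookup s) x ≡ map (lookup t) x
  X ⊨ (∼ φ) = IsEmpty X ⊎ ¬ (X ⊨ (φ))
  X ⊨ (φ ∧ ψ) = (X ⊨ (φ)) × (X ⊨ (ψ))
  X ⊨ (φ ∨ ψ) = (X ⊨ (φ)) ⊎ (X ⊨ (ψ))
  X ⊨ (∃¹ φ) = Σ Carrier λ a → extend X a ⊨ (φ)
  X ⊨ (∀¹ φ) = ∀ a → extend X a ⊨ (φ)

module _ {σ : Signature} {𝔄 𝔅 : Structure σ} (f : PartialTeamMap 𝔄 𝔅) where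
  open PartialTeamMap f
  private
    A = Structure.Carrier 𝔄

  PreservesQFFormulas : Set₁
  PreservesQFFormulas = ∀ {n} (φ : Formula σ n) → QuantifierFree σ φ →
    ∀ {X : Rel A n} (p : dom X) → Iff (_⊨_ 𝔄 X φ) (_⊨_ 𝔅 (app X p) φ)

  PreservesAllFormulas : Set₁
  PreservesAllFormulas = ∀ {n} (φ : Formula σ n) →
    ∀ {X : Rel A n} (p : dom X) → Iff (_⊨_ 𝔄 X φ) (_⊨_ 𝔅 (app X p) φ)

  IsPartialElementaryTeamMap : Set₁
  IsPartialElementaryTeamMap = PreservesProducts f × PreservesAllFormulas

module Submission where

open import Defs
open import Level using (Level)
open import Data.Nat using (ℕ; zero; suc; _+_)
open import Data.Fin using (Fin; zero; suc; _↑ˡ_; _↑ʳ_; inject₁; fromℕ)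
open import Data.Vec using (Vec; []; _∷_; _++_; map; lookup; _∷ʳ_; tabulate; allFin; splitAt; initLast)
open import Data.Vec.Properties
  using (tabulate-∘; tabulate-cong; tabulate∘lookup; lookup-++ˡ; lookup-++ʳ; map-∘; map-cong; map-∷ʳ; map-++;
         map-lookup-allFin; ++-injective; ∷-injective; ∷-injectiveˡ; ∷ʳ-injective)
open import Data.Product using (Σ; _×_; _,_; proj₁; proj₂; swap)
import Data.Product as Product
open import Data.Sum using (_⊎_; inj₁; inj₂)
import Data.Sum as Sum
open import Data.Empty using (⊥-elim)
open import Data.Unit using (tt)
open import Relation.Nullary using (¬_; yes; no)
open import Relation.Binary.PropositionalEquality
  using (_≡_; refl; sym; trans; cong; cong₂; subst; module ≡-Reasoning)
open import Function using (_∘_; id)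

-- (1) ⇒ (2): every first-order atomic formula λ(v⃗) holds in a team X iff X ⊆ R_λ for a relation R_λ built
-- from the atomic relations by ∩, × and projections, and a team isomorphism maps each such R_λ^𝔄 to R_λ^𝔅.
-- Inclusion atoms compare two projections of X, a dependence atom says that a projection of X is empty or
-- a singleton, and ∼ only needs emptiness, so all of these are preserved as well.
--
-- (2) ⇒ (1): each clause of the definition of a team isomorphism is a quantifier-free property of X or of
-- X × Y: emptiness is ∼=(), a singleton is a nonempty team satisfying =(v⃗), X ⊆ Y and Y = Pr_ı(X) are
-- inclusion atoms between the two halves of X × Y (together with nonemptiness conditions), and the
-- relations of the signature are defined by atomic formulas. Excluded middle turns the preserved
-- non-emptiness into witnesses.

private
  variable
    a b c d : Level
    P : Set a
    Q : Set b
    R : Set c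
    S : Set d

Iff-refl : Iff P P
Iff-refl = id , id

Iff-sym : Iff P Q → Iff Q P
Iff-sym = swap

Iff-trans : Iff P Q → Iff Q R → Iff P R
Iff-trans (p⇒q , q⇒p) (q⇒r , r⇒q) = q⇒r ∘ p⇒q , q⇒p ∘ r⇒q

Iff-× : Iff P Q → Iff R S → Iff (P × R) (Q × S)
Iff-× (p⇒q , q⇒p) (r⇒s , s⇒r) = Product.map p⇒q r⇒s , Product.map q⇒p s⇒r

Iff-⊎ : Iff P Q → Iff R S → Iff (P ⊎ R) (Q ⊎ S)
Iff-⊎ (p⇒q , q⇒p) (r⇒s , s⇒r) = Sum.map p⇒q r⇒s , Sum.map q⇒p s⇒r

Iff-→ : Iff P Q → Iff R S → Iff (P → R) (Q → S)
Iff-→ (p⇒q , q⇒p) (r⇒s , s⇒r) = (λ p⇒r → r⇒s ∘ p⇒r ∘ q⇒p) , (λ q⇒s → s⇒r ∘ q⇒s ∘ p⇒q)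

Iff-¬ : Iff P Q → Iff (¬ P) (¬ Q)
Iff-¬ P⇔Q = Iff-→ P⇔Q Iff-refl

Iff-Σ : {A : Set a} {P : A → Set b} {Q : A → Set c} → (∀ x → Iff (P x) (Q x)) → Iff (Σ A P) (Σ A Q)
Iff-Σ P⇔Q = Product.map₂ (λ {x} → proj₁ (P⇔Q x)) , Product.map₂ (λ {x} → proj₂ (P⇔Q x))

leftIndices : ∀ n m → Vec (Fin (n + m)) n
leftIndices n m = tabulate (_↑ˡ m)

rightIndices : ∀ n m → Vec (Fin (n + m)) m
rightIndices n m = tabulate (n ↑ʳ_)

module _ {A : Set} where
  open ≡-Reasoning

  map-lookup-tabulate : ∀ {N n} (v : Vec A N) (g : Fin n → Fin N) {w : Vec A n} →
                        (∀ i → lookup v (g i) ≡ lookup w i) → map (lookup v) (tabulate g) ≡ w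
  map-lookup-tabulate v g {w} v∘g≗w = begin
    map (lookup v) (tabulate g) ≡⟨ tabulate-∘ (lookup v) g ⟨
    tabulate (lookup v ∘ g)     ≡⟨ tabulate-cong v∘g≗w ⟩
    tabulate (lookup w)         ≡⟨ tabulate∘lookup w ⟩
    w                           ∎

  map-lookup-++-leftIndices : ∀ {n m} (u : Vec A n) (v : Vec A m) → map (lookup (u ++ v)) (leftIndices n m) ≡ u
  map-lookup-++-leftIndices u v = map-lookup-tabulate (u ++ v) _ (lookup-++ˡ u v)

  map-lookup-++-rightIndices : ∀ {n m} (u : Vec A n) (v : Vec A m) →
                               map (lookup (u ++ v)) (rightIndices n m) ≡ v
  map-lookup-++-rightIndices u v = map-lookup-tabulate (u ++ v) _ (lookup-++ʳ u v)

  map-lookup-++-↑ˡ : ∀ {n m k} (ı : Vec (Fin n) k) (u : Vec A n) (v : Vec A m) →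
                     map (lookup (u ++ v)) (map (_↑ˡ m) ı) ≡ map (lookup u) ı
  map-lookup-++-↑ˡ {m = m} ı u v = begin
    map (lookup (u ++ v)) (map (_↑ˡ m) ı) ≡⟨ map-∘ (lookup (u ++ v)) (_↑ˡ m) ı ⟨
    map (lookup (u ++ v) ∘ (_↑ˡ m)) ı     ≡⟨ map-cong (lookup-++ˡ u v) ı ⟩
    map (lookup u) ı                      ∎

  lookup-∷ʳ-inject₁ : ∀ {k} (v : Vec A k) (x : A) (i : Fin k) → lookup (v ∷ʳ x) (inject₁ i) ≡ lookup v i
  lookup-∷ʳ-inject₁ (_ ∷ v) x zero    = refl
  lookup-∷ʳ-inject₁ (_ ∷ v) x (suc i) = lookup-∷ʳ-inject₁ v x i

  lookup-∷ʳ-fromℕ : ∀ {k} (v : Vec A k) (x : A) → lookup (v ∷ʳ x) (fromℕ k) ≡ x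
  lookup-∷ʳ-fromℕ []      x = refl
  lookup-∷ʳ-fromℕ (_ ∷ v) x = lookup-∷ʳ-fromℕ v x

module _ {A : Set} where

  Inhabited : ∀ {n} → Rel A n → Set
  Inhabited {n} X = Σ (Vec A n) X

  Inhabited⇔¬IsEmpty : (lem : ∀ {ℓ} → ExcludedMiddle ℓ) → ∀ {n} (X : Rel A n) →
                       Iff (Inhabited X) (¬ IsEmpty X)
  Inhabited⇔¬IsEmpty lem X = (λ (v , Xv) X-empty → X-empty v Xv) , from
    where
    from : ¬ IsEmpty X → Inhabited X
    from X-nonempty with lem {P = Inhabited X}
    ... | yes inhabited = inhabited
    ... | no ¬inhabited = ⊥-elim (X-nonempty λ v Xv → ¬inhabited (v , Xv))

  IsFull⇔full⊆ : ∀ {n} (X : Rel A n) → Iff (IsFull X) (fullRel n ⊆ X)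
  IsFull⇔full⊆ X = (λ X-full v _ → X-full v) , (λ full⊆X v → full⊆X v tt)

  ≐-refl : ∀ {n} {X : Rel A n} → X ≐ X
  ≐-refl = (λ _ → id) , (λ _ → id)

  ≐-sym : ∀ {n} {X Y : Rel A n} → X ≐ Y → Y ≐ X
  ≐-sym = swap

  ≐-trans : ∀ {n} {X Y Z : Rel A n} → X ≐ Y → Y ≐ Z → X ≐ Z
  ≐-trans (X⊆Y , Y⊆X) (Y⊆Z , Z⊆Y) = (λ v → Y⊆Z v ∘ X⊆Y v) , (λ v → Y⊆X v ∘ Z⊆Y v)

  ⊆-resp-≐ : ∀ {n} {X X′ Y Y′ : Rel A n} → X ≐ X′ → Y ≐ Y′ → Iff (X ⊆ Y) (X′ ⊆ Y′)
  ⊆-resp-≐ (X⊆X′ , X′⊆X) (Y⊆Y′ , Y′⊆Y) =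
    (λ X⊆Y v → Y⊆Y′ v ∘ X⊆Y v ∘ X′⊆X v) , (λ X′⊆Y′ v → Y′⊆Y v ∘ X′⊆Y′ v ∘ X⊆X′ v)

  IsEmpty-resp-≐ : ∀ {n} {X Y : Rel A n} → X ≐ Y → Iff (IsEmpty X) (IsEmpty Y)
  IsEmpty-resp-≐ (X⊆Y , Y⊆X) = (λ X-empty v → X-empty v ∘ Y⊆X v) , (λ Y-empty v → Y-empty v ∘ X⊆Y v)

  IsSingleton-resp-≐ : ∀ {n} {X Y : Rel A n} → X ≐ Y → Iff (IsSingleton X) (IsSingleton Y)
  IsSingleton-resp-≐ (X⊆Y , Y⊆X) =
    (λ (a , X≡a) → a , λ v → proj₁ (X≡a v) ∘ Y⊆X v , X⊆Y v ∘ proj₂ (X≡a v)) ,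
    (λ (a , Y≡a) → a , λ v → proj₁ (Y≡a v) ∘ X⊆Y v , Y⊆X v ∘ proj₂ (Y≡a v))

  ∩-cong : ∀ {n} {X X′ Y Y′ : Rel A n} → X ≐ X′ → Y ≐ Y′ → (X ∩ Y) ≐ (X′ ∩ Y′)
  ∩-cong (X⊆X′ , X′⊆X) (Y⊆Y′ , Y′⊆Y) =
    (λ v → Product.map (X⊆X′ v) (Y⊆Y′ v)) , (λ v → Product.map (X′⊆X v) (Y′⊆Y v))

  ⊗-cong : ∀ {n m} {X X′ : Rel A n} {Y Y′ : Rel A m} → X ≐ X′ → Y ≐ Y′ → (X ⊗ Y) ≐ (X′ ⊗ Y′)
  ⊗-cong (X⊆X′ , X′⊆X) (Y⊆Y′ , Y′⊆Y) =
    (λ { _ (u , v , eq , Xu , Yv) → u , v , eq , X⊆X′ u Xu , Y⊆Y′ v Yv }) ,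
    (λ { _ (u , v , eq , Xu , Yv) → u , v , eq , X′⊆X u Xu , Y′⊆Y v Yv })

  Pr-cong : ∀ {n m} (ı : Vec (Fin n) m) {X Y : Rel A n} → X ≐ Y → Pr ı X ≐ Pr ı Y
  Pr-cong ı (X⊆Y , Y⊆X) =
    (λ { _ (v , Xv , eq) → v , X⊆Y v Xv , eq }) , (λ { _ (v , Yv , eq) → v , Y⊆X v Yv , eq })

  Pr-allFin : ∀ {n} (X : Rel A n) → Pr (allFin n) X ≐ X
  Pr-allFin X = (λ { _ (v , Xv , refl) → subst X (sym (map-lookup-allFin v)) Xv }) ,
                λ v Xv → v , Xv , sym (map-lookup-allFin v)

data ClExpr (σ : Signature) : ℕ → Set where
  ‵full  : ∀ n → ClExpr σ n
  ‵diag  : ClExpr σ 2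
  ‵rel   : (R : Signature.RelSym σ) → ClExpr σ (Signature.relAr σ R)
  ‵graph : (F : Signature.FunSym σ) → ClExpr σ (suc (Signature.funAr σ F))
  ‵const : Signature.ConSym σ → ClExpr σ 1
  _‵∩_   : ∀ {n} → ClExpr σ n → ClExpr σ n → ClExpr σ n
  _‵⊗_   : ∀ {n m} → ClExpr σ n → ClExpr σ m → ClExpr σ (n + m)
  ‵Pr    : ∀ {n m} → Vec (Fin n) m → ClExpr σ n → ClExpr σ m

⟦_⟧ : ∀ {σ n} → ClExpr σ n → (𝔐 : Structure σ) → Rel (Structure.Carrier 𝔐) n
⟦ ‵full n  ⟧ 𝔐 = fullRel n
⟦ ‵diag    ⟧ 𝔐 = diag
⟦ ‵rel R   ⟧ 𝔐 = Structure.relI 𝔐 R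
⟦ ‵graph F ⟧ 𝔐 = Graph 𝔐 F
⟦ ‵const c ⟧ 𝔐 = ConstRel 𝔐 c
⟦ e ‵∩ e′  ⟧ 𝔐 = ⟦ e ⟧ 𝔐 ∩ ⟦ e′ ⟧ 𝔐
⟦ e ‵⊗ e′  ⟧ 𝔐 = ⟦ e ⟧ 𝔐 ⊗ ⟦ e′ ⟧ 𝔐
⟦ ‵Pr ı e  ⟧ 𝔐 = Pr ı (⟦ e ⟧ 𝔐)

module _ {σ : Signature} where
  open Signature σ

  -- {w | w∘ı ∈ e}, as the first half of {u ++ u∘ı} ∩ (Aⁿ × e)
  ‵preimage : ∀ {n m} → Vec (Fin n) m → ClExpr σ m → ClExpr σ n
  ‵preimage {n} {m} ı e = ‵Pr (leftIndices n m) (‵Pr (allFin n ++ ı) (‵full n) ‵∩ (‵full n ‵⊗ e))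

  ‵∃ : ∀ k {n} → ClExpr σ (k + n) → ClExpr σ n
  ‵∃ k {n} e = ‵Pr (rightIndices k n) e

  mutual
    ‵termGraph : ∀ {n} → Term σ n → ClExpr σ (suc n)
    ‵termGraph (var i)   = ‵preimage (zero ∷ suc i ∷ []) ‵diag
    ‵termGraph (con c)   = ‵preimage (zero ∷ []) (‵const c)
    ‵termGraph {n} (fapp F ts) =
      ‵∃ k (‵preimage (leftIndices k (suc n) ∷ʳ (k ↑ʳ zero)) (‵graph F)
            ‵∩ ‵termsGraphAt ts (leftIndices k (suc n)) (tabulate (λ i → k ↑ʳ suc i)))
      where k = funAr F

    ‵termsGraphAt : ∀ {n N k} → Vec (Term σ n) k → Vec (Fin N) k → Vec (Fin N) n → ClExpr σ N
    ‵termsGraphAt {N = N} []       []       args = ‵full N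
    ‵termsGraphAt         (t ∷ ts) (p ∷ ps) args =
      ‵preimage (p ∷ args) (‵termGraph t) ‵∩ ‵termsGraphAt ts ps args

  ‵atom : ∀ {n} → Atomic σ n → ClExpr σ n
  ‵atom (t ≈ u) = ‵∃ 1 (‵termGraph t ‵∩ ‵termGraph u)
  ‵atom {n} (rel R ts) =
    ‵∃ r (‵preimage (leftIndices r n) (‵rel R) ‵∩ ‵termsGraphAt ts (leftIndices r n) (rightIndices r n))
    where r = relAr R

module _ {σ : Signature} (𝔐 : Structure σ) where
  open Signature σ
  open Structure 𝔐 renaming (Carrier to M)
  open ≡-Reasoning

  ⟦‵preimage⟧ : ∀ {n m} (ı : Vec (Fin n) m) (e : ClExpr σ m) (w : Vec M n) →
                Iff (⟦ ‵preimage ı e ⟧ 𝔐 w) (⟦ e ⟧ 𝔐 (map (lookup w) ı))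
  ⟦‵preimage⟧ {n} {m} ı e w = to , from
    where
    pair : ∀ u → map (lookup u) (allFin n ++ ı) ≡ u ++ map (lookup u) ı
    pair u = trans (map-++ (lookup u) (allFin n) ı) (cong (_++ map (lookup u) ı) (map-lookup-allFin u))

    to : ⟦ ‵preimage ı e ⟧ 𝔐 w → ⟦ e ⟧ 𝔐 (map (lookup w) ı)
    to (._ , ((u , _ , refl) , (u′ , v , pair≡u′++v , _ , ev)) , w≡left) = subst (⟦ e ⟧ 𝔐) v≡w∘ı ev
      where
      w≡u : w ≡ u
      w≡u = trans w≡left (trans (cong (λ x → map (lookup x) (leftIndices n m)) (pair u))
                                (map-lookup-++-leftIndices u _))
      v≡w∘ı : v ≡ map (lookup w) ı
      v≡w∘ı = begin
        v                ≡⟨ proj₂ (++-injective u u′ (trans (sym (pair u)) pair≡u′++v)) ⟨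
        map (lookup u) ı ≡⟨ cong (λ x → map (lookup x) ı) w≡u ⟨
        map (lookup w) ı ∎

    from : ⟦ e ⟧ 𝔐 (map (lookup w) ı) → ⟦ ‵preimage ı e ⟧ 𝔐 w
    from ew = w ++ map (lookup w) ı , ((w , tt , sym (pair w)) , (w , _ , refl , tt , ew)) ,
              sym (map-lookup-++-leftIndices w _)

  ⟦‵∃⟧ : ∀ k {n} (e : ClExpr σ (k + n)) (w : Vec M n) →
         Iff (⟦ ‵∃ k e ⟧ 𝔐 w) (Σ (Vec M k) λ z → ⟦ e ⟧ 𝔐 (z ++ w))
  ⟦‵∃⟧ k e w = to , λ (z , ez) → z ++ w , ez , sym (map-lookup-++-rightIndices z w)
    where
    to : ⟦ ‵∃ k e ⟧ 𝔐 w → Σ (Vec M k) λ z → ⟦ e ⟧ 𝔐 (z ++ w)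
    to (v , ev , w≡right) with splitAt k v
    ... | z , w′ , refl =
      z , subst (λ x → ⟦ e ⟧ 𝔐 (z ++ x)) (sym (trans w≡right (map-lookup-++-rightIndices z w′))) ev

  Graph-∷ʳ : ∀ F (z : Vec M (funAr F)) (y : M) → Iff (Graph 𝔐 F (z ∷ʳ y)) (y ≡ funI F z)
  Graph-∷ʳ F z y = (λ (z′ , eq) → to (∷ʳ-injective z z′ eq)) , λ y≡Fz → z , cong (z ∷ʳ_) y≡Fz
    where
    to : ∀ {z′} → z ≡ z′ × y ≡ funI F z′ → y ≡ funI F z
    to (refl , y≡Fz) = y≡Fz

  mutual
    ⟦‵termGraph⟧ : ∀ {n} (t : Term σ n) (y : M) (s : Vec M n) →
                   Iff (⟦ ‵termGraph t ⟧ 𝔐 (y ∷ s)) (y ≡ evalTerm 𝔐 s t)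
    ⟦‵termGraph⟧ (var i) y s = ⟦‵preimage⟧ _ ‵diag (y ∷ s)
    ⟦‵termGraph⟧ (con c) y s = Iff-trans (⟦‵preimage⟧ _ (‵const c) (y ∷ s)) (∷-injectiveˡ , cong (_∷ []))
    ⟦‵termGraph⟧ {n} (fapp F ts) y s =
      Iff-trans (⟦‵∃⟧ k (‵preimage valuesAndResult (‵graph F) ‵∩ ‵termsGraphAt ts values args) (y ∷ s))
        (Iff-trans (Iff-Σ λ z → Iff-× (Iff-trans (⟦‵preimage⟧ valuesAndResult (‵graph F) _) (graph-at z))
                                      (Iff-trans (⟦‵termsGraphAt⟧ ts values args _) (args-at z)))
                   one-point)
      where
      k = funAr F
      values = leftIndices k (suc n)
      args = tabulate (λ i → k ↑ʳ suc i)
      valuesAndResult = values ∷ʳ (k ↑ʳ zero)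
      args-at-right : ∀ z → map (lookup (z ++ y ∷ s)) args ≡ s
      args-at-right z = map-lookup-tabulate (z ++ y ∷ s) _ (λ i → lookup-++ʳ z (y ∷ s) (suc i))
      graph-at : ∀ z → Iff (Graph 𝔐 F (map (lookup (z ++ y ∷ s)) valuesAndResult)) (y ≡ funI F z)
      graph-at z rewrite map-∷ʳ (lookup (z ++ y ∷ s)) (k ↑ʳ zero) values
                       | map-lookup-++-leftIndices z (y ∷ s) | lookup-++ʳ z (y ∷ s) zero = Graph-∷ʳ F z y
      args-at : ∀ z → Iff (map (lookup (z ++ y ∷ s)) values ≡ evalTerms 𝔐 (map (lookup (z ++ y ∷ s)) args) ts)
                          (z ≡ evalTerms 𝔐 s ts)
      args-at z rewrite map-lookup-++-leftIndices z (y ∷ s) | args-at-right z = Iff-refl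
      one-point : Iff (Σ (Vec M k) λ z → y ≡ funI F z × z ≡ evalTerms 𝔐 s ts) (y ≡ evalTerm 𝔐 s (fapp F ts))
      one-point = (λ { (_ , y≡Fz , refl) → y≡Fz }) , λ y≡Fts → _ , y≡Fts , refl

    ⟦‵termsGraphAt⟧ : ∀ {n N k} (ts : Vec (Term σ n) k) (ps : Vec (Fin N) k) (args : Vec (Fin N) n)
                      (w : Vec M N) →
      Iff (⟦ ‵termsGraphAt ts ps args ⟧ 𝔐 w) (map (lookup w) ps ≡ evalTerms 𝔐 (map (lookup w) args) ts)
    ⟦‵termsGraphAt⟧ []       []       args w = (λ _ → refl) , (λ _ → tt)
    ⟦‵termsGraphAt⟧ (t ∷ ts) (p ∷ ps) args w =
      Iff-trans (Iff-× (Iff-trans (⟦‵preimage⟧ (p ∷ args) (‵termGraph t) w) (⟦‵termGraph⟧ t _ _))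
                       (⟦‵termsGraphAt⟧ ts ps args w))
                ((λ (head≡ , tail≡) → cong₂ _∷_ head≡ tail≡) , ∷-injective)

  ⟦‵atom⟧ : ∀ {n} (a : Atomic σ n) (s : Vec M n) → Iff (⟦ ‵atom a ⟧ 𝔐 s) (holdsAt 𝔐 a s)
  ⟦‵atom⟧ (t ≈ u) s =
    Iff-trans (⟦‵∃⟧ 1 (‵termGraph t ‵∩ ‵termGraph u) s)
      (Iff-trans (Iff-Σ λ { (y ∷ []) → Iff-× (⟦‵termGraph⟧ t y s) (⟦‵termGraph⟧ u y s) }) one-point)
    where
    one-point : Iff (Σ (Vec M 1) λ { (y ∷ []) → y ≡ evalTerm 𝔐 s t × y ≡ evalTerm 𝔐 s u })
                    (evalTerm 𝔐 s t ≡ evalTerm 𝔐 s u)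
    one-point = (λ { (_ ∷ [] , refl , y≡u) → y≡u }) , λ t≡u → _ ∷ [] , refl , t≡u
  ⟦‵atom⟧ {n} (rel R ts) s =
    Iff-trans (⟦‵∃⟧ r (‵preimage values (‵rel R) ‵∩ ‵termsGraphAt ts values args) s)
      (Iff-trans (Iff-Σ λ z → Iff-× (Iff-trans (⟦‵preimage⟧ values (‵rel R) _) (rel-at z))
                                    (Iff-trans (⟦‵termsGraphAt⟧ ts values args _) (args-at z)))
                 one-point)
    where
    r = relAr R
    values = leftIndices r n
    args = rightIndices r n
    rel-at : ∀ z → Iff (relI R (map (lookup (z ++ s)) values)) (relI R z)
    rel-at z rewrite map-lookup-++-leftIndices z s = Iff-refl
    args-at : ∀ z → Iff (map (lookup (z ++ s)) values ≡ evalTerms 𝔐 (map (lookup (z ++ s)) args) ts)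
                        (z ≡ evalTerms 𝔐 s ts)
    args-at z rewrite map-lookup-++-leftIndices z s | map-lookup-++-rightIndices z s = Iff-refl
    one-point : Iff (Σ (Vec M r) λ z → relI R z × z ≡ evalTerms 𝔐 s ts) (relI R (evalTerms 𝔐 s ts))
    one-point = (λ { (_ , Rz , refl) → Rz }) , λ Rts → _ , Rts , refl

infix 4 _∣_⊨_

_∣_⊨_ : ∀ {σ n} (𝔐 : Structure σ) → Rel (Structure.Carrier 𝔐) n → Formula σ n → Set
𝔐 ∣ X ⊨ φ = _⊨_ 𝔐 X φ

module _ {σ : Signature} where
  open Signature σ

  emptinessFormula : ∀ {n} → Formula σ n
  emptinessFormula = ∼ dep []

  constancyFormula : ∀ {n} → Formula σ n
  constancyFormula {n} = dep (allFin n)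

  -- on a team X ⊗ Y: Pr ı (X-part) ⊆ Y-part, resp. Y-part ⊆ Pr ı (X-part)
  Pr⊆Formula ⊆PrFormula : ∀ {n m} → Vec (Fin n) m → Formula σ (n + m)
  Pr⊆Formula {n} {m} ı = incl (map (_↑ˡ m) ı) (rightIndices n m)
  ⊆PrFormula {n} {m} ı = incl (rightIndices n m) (map (_↑ˡ m) ı)

  diagFormula : Formula σ 2
  diagFormula = atom (var zero ≈ var (suc zero))

  relFormula : ∀ R → Formula σ (relAr R)
  relFormula R = atom (rel R (tabulate var))

  graphFormula : ∀ F → Formula σ (suc (funAr F))
  graphFormula F = atom (fapp F (tabulate (var ∘ inject₁)) ≈ var (fromℕ (funAr F)))

  constFormula : ConSym → Formula σ 1
  constFormula c = atom (con c ≈ var zero)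

module _ {σ : Signature} (𝔐 : Structure σ) where
  open Signature σ
  open Structure 𝔐 renaming (Carrier to M)

  extend-cong : ∀ {n} {X Y : Rel M n} → X ≐ Y → (x : M) → extend 𝔐 X x ≐ extend 𝔐 Y x
  extend-cong (X⊆Y , Y⊆X) x =
    (λ { _ (s , Xs , eq) → s , X⊆Y s Xs , eq }) , (λ { _ (s , Ys , eq) → s , Y⊆X s Ys , eq })

  ⊨-resp-≐ : ∀ {n} (φ : Formula σ n) {X Y : Rel M n} → X ≐ Y → 𝔐 ∣ X ⊨ φ → 𝔐 ∣ Y ⊨ φ
  ⊨-resp-≐ (atom a)   (_ , Y⊆X)   X⊨a s Ys         = X⊨a s (Y⊆X s Ys)
  ⊨-resp-≐ (incl x y) (X⊆Y , Y⊆X) X⊨x⊆y s Ys       = Product.map₂ (Product.map₁ (X⊆Y _)) (X⊨x⊆y s (Y⊆X s Ys))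
  ⊨-resp-≐ (dep x)    (_ , Y⊆X)   X⊨dep s t Ys Yt  = X⊨dep s t (Y⊆X s Ys) (Y⊆X t Yt)
  ⊨-resp-≐ (∼ φ)      X≐Y (inj₁ X-empty) = inj₁ (proj₁ (IsEmpty-resp-≐ X≐Y) X-empty)
  ⊨-resp-≐ (∼ φ)      X≐Y (inj₂ X⊭φ)     = inj₂ (X⊭φ ∘ ⊨-resp-≐ φ (≐-sym X≐Y))
  ⊨-resp-≐ (φ ∧ ψ)    X≐Y (X⊨φ , X⊨ψ)   = ⊨-resp-≐ φ X≐Y X⊨φ , ⊨-resp-≐ ψ X≐Y X⊨ψ
  ⊨-resp-≐ (φ ∨ ψ)    X≐Y (inj₁ X⊨φ)    = inj₁ (⊨-resp-≐ φ X≐Y X⊨φ)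
  ⊨-resp-≐ (φ ∨ ψ)    X≐Y (inj₂ X⊨ψ)    = inj₂ (⊨-resp-≐ ψ X≐Y X⊨ψ)
  ⊨-resp-≐ (∃¹ φ)     X≐Y (x , X[x]⊨φ)  = x , ⊨-resp-≐ φ (extend-cong X≐Y x) X[x]⊨φ
  ⊨-resp-≐ (∀¹ φ)     X≐Y X[-]⊨φ x      = ⊨-resp-≐ φ (extend-cong X≐Y x) (X[-]⊨φ x)

  ⊨incl⇔Pr⊆Pr : ∀ {n k} (x y : Vec (Fin n) k) (X : Rel M n) → Iff (𝔐 ∣ X ⊨ incl x y) (Pr x X ⊆ Pr y X)
  ⊨incl⇔Pr⊆Pr x y X =
    (λ { X⊨x⊆y _ (s , Xs , refl) → X⊨x⊆y s Xs }) , λ Prx⊆Pry s Xs → Prx⊆Pry _ (s , Xs , refl)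

  ⊨dep⇔IsEmpty⊎IsSingleton : (lem : ∀ {ℓ} → ExcludedMiddle ℓ) → ∀ {n k} (x : Vec (Fin n) k) (X : Rel M n) →
    Iff (𝔐 ∣ X ⊨ dep x) (IsEmpty (Pr x X) ⊎ IsSingleton (Pr x X))
  ⊨dep⇔IsEmpty⊎IsSingleton lem x X = to , from
    where
    to : 𝔐 ∣ X ⊨ dep x → IsEmpty (Pr x X) ⊎ IsSingleton (Pr x X)
    to X⊨dep with lem {P = Inhabited X}
    ... | no  ¬inhabited = inj₁ λ { _ (v , Xv , _) → ¬inhabited (v , Xv) }
    ... | yes (s , Xs)   =
      inj₂ (map (lookup s) x , λ _ → (λ { (v , Xv , refl) → X⊨dep v s Xv Xs }) , λ { refl → s , Xs , refl })
    from : IsEmpty (Pr x X) ⊎ IsSingleton (Pr x X) → 𝔐 ∣ X ⊨ dep x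
    from (inj₁ Pr-empty)   s t Xs Xt = ⊥-elim (Pr-empty _ (s , Xs , refl))
    from (inj₂ (a , Pr≡a)) s t Xs Xt = trans (proj₁ (Pr≡a _) (s , Xs , refl)) (sym (proj₁ (Pr≡a _) (t , Xt , refl)))

  ⊨emptiness⇔IsEmpty : ∀ {n} (X : Rel M n) → Iff (𝔐 ∣ X ⊨ emptinessFormula) (IsEmpty X)
  ⊨emptiness⇔IsEmpty X =
    (λ { (inj₁ X-empty) → X-empty ; (inj₂ X⊭dep[]) → ⊥-elim (X⊭dep[] λ _ _ _ _ → refl) }) , inj₁

  IsSingleton⇔Inhabited×⊨constancy : ∀ {n} (X : Rel M n) →
    Iff (IsSingleton X) (Inhabited X × 𝔐 ∣ X ⊨ constancyFormula)
  IsSingleton⇔Inhabited×⊨constancy X = to , from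
    where
    to : IsSingleton X → Inhabited X × 𝔐 ∣ X ⊨ constancyFormula
    to (a , X≡a) = (a , proj₂ (X≡a a) refl) , λ s t Xs Xt →
      cong (λ v → map (lookup v) (allFin _)) (trans (proj₁ (X≡a s) Xs) (sym (proj₁ (X≡a t) Xt)))
    from : Inhabited X × 𝔐 ∣ X ⊨ constancyFormula → IsSingleton X
    from ((a , Xa) , X⊨const) = a , λ v →
      (λ Xv → trans (sym (map-lookup-allFin v)) (trans (X⊨const v a Xv Xa) (map-lookup-allFin a))) ,
      λ { refl → Xa }

  -- The inhabitation conjunct is needed: for Y = ∅ the team X ⊗ Y is empty and satisfies every atom.
  Pr⊆⇔⊗⊨Pr⊆Formula : ∀ {n m} (ı : Vec (Fin n) m) (X : Rel M n) (Y : Rel M m) →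
    Iff (Pr ı X ⊆ Y) ((Inhabited X → Inhabited Y) × 𝔐 ∣ X ⊗ Y ⊨ Pr⊆Formula ı)
  Pr⊆⇔⊗⊨Pr⊆Formula {n} {m} ı X Y = to , from
    where
    to : Pr ı X ⊆ Y → (Inhabited X → Inhabited Y) × 𝔐 ∣ X ⊗ Y ⊨ Pr⊆Formula ı
    to Pr⊆Y = (λ (u , Xu) → _ , Pr⊆Y _ (u , Xu , refl)) ,
              λ { _ (u , v , refl , Xu , _) →
                    u ++ map (lookup u) ı , (u , _ , refl , Xu , Pr⊆Y _ (u , Xu , refl)) ,
                    trans (map-lookup-++-↑ˡ ı u v) (sym (map-lookup-++-rightIndices u _)) }
    from : (Inhabited X → Inhabited Y) × 𝔐 ∣ X ⊗ Y ⊨ Pr⊆Formula ı → Pr ı X ⊆ Y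
    from (inhabited , ⊗⊨Pr⊆) _ (u , Xu , refl) with inhabited (u , Xu)
    ... | b , Yb with ⊗⊨Pr⊆ (u ++ b) (u , b , refl , Xu , Yb)
    ... | _ , (u′ , v′ , refl , _ , Yv′) , eq =
      subst Y (trans (sym (map-lookup-++-rightIndices u′ v′)) (trans (sym eq) (map-lookup-++-↑ˡ ı u b))) Yv′

  ⊆Pr⇔⊗⊨⊆PrFormula : ∀ {n m} (ı : Vec (Fin n) m) (X : Rel M n) (Y : Rel M m) →
    Iff (Y ⊆ Pr ı X) ((Inhabited Y → Inhabited X) × 𝔐 ∣ X ⊗ Y ⊨ ⊆PrFormula ı)
  ⊆Pr⇔⊗⊨⊆PrFormula {n} {m} ı X Y = to , from
    where
    to : Y ⊆ Pr ı X → (Inhabited Y → Inhabited X) × 𝔐 ∣ X ⊗ Y ⊨ ⊆PrFormula ı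
    to Y⊆Pr = (λ (v , Yv) → Product.map₂ proj₁ (Y⊆Pr v Yv)) ,
              λ { _ (u , v , refl , _ , Yv) → let (u′ , Xu′ , v≡u′∘ı) = Y⊆Pr v Yv in
                    u′ ++ v , (u′ , v , refl , Xu′ , Yv) ,
                    trans (map-lookup-++-rightIndices u v) (trans v≡u′∘ı (sym (map-lookup-++-↑ˡ ı u′ v))) }
    from : (Inhabited Y → Inhabited X) × 𝔐 ∣ X ⊗ Y ⊨ ⊆PrFormula ı → Y ⊆ Pr ı X
    from (inhabited , ⊗⊨⊆Pr) v Yv with inhabited (v , Yv)
    ... | a , Xa with ⊗⊨⊆Pr (a ++ v) (a , v , refl , Xa , Yv)
    ... | _ , (u′ , v′ , refl , Xu′ , _) , eq =
      u′ , Xu′ , trans (sym (map-lookup-++-rightIndices a v)) (trans eq (map-lookup-++-↑ˡ ı u′ v′))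

  ⊆⇔⊗⊨Pr⊆Formula : ∀ {n} (X Y : Rel M n) →
    Iff (X ⊆ Y) ((Inhabited X → Inhabited Y) × 𝔐 ∣ X ⊗ Y ⊨ Pr⊆Formula (allFin n))
  ⊆⇔⊗⊨Pr⊆Formula X Y = Iff-trans (⊆-resp-≐ (≐-sym (Pr-allFin X)) ≐-refl) (Pr⊆⇔⊗⊨Pr⊆Formula (allFin _) X Y)

  Pr≐⇔⊗⊨ : ∀ {n m} (ı : Vec (Fin n) m) (X : Rel M n) (Y : Rel M m) →
    Iff (Pr ı X ≐ Y) (((Inhabited X → Inhabited Y) × 𝔐 ∣ X ⊗ Y ⊨ Pr⊆Formula ı) ×
                      ((Inhabited Y → Inhabited X) × 𝔐 ∣ X ⊗ Y ⊨ ⊆PrFormula ı))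
  Pr≐⇔⊗⊨ ı X Y = Iff-× (Pr⊆⇔⊗⊨Pr⊆Formula ı X Y) (⊆Pr⇔⊗⊨⊆PrFormula ı X Y)

  Defines : ∀ {n} → Formula σ n → Rel M n → Set₁
  Defines φ R = ∀ X → Iff (𝔐 ∣ X ⊨ φ) (X ⊆ R)

  atom-defines : ∀ {n} (a : Atomic σ n) → Defines (atom a) (⟦ ‵atom a ⟧ 𝔐)
  atom-defines a X =
    (λ X⊨a s → proj₂ (⟦‵atom⟧ 𝔐 a s) ∘ X⊨a s) , (λ X⊆a s → proj₁ (⟦‵atom⟧ 𝔐 a s) ∘ X⊆a s)

  diagFormula-defines : Defines diagFormula diag
  diagFormula-defines X = (λ { X⊨φ (_ ∷ _ ∷ []) → X⊨φ _ }) , (λ { X⊆diag (_ ∷ _ ∷ []) → X⊆diag _ })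

  evalTerms-tabulate : ∀ {n k} (s : Vec M n) (g : Fin k → Term σ n) →
                       evalTerms 𝔐 s (tabulate g) ≡ tabulate (evalTerm 𝔐 s ∘ g)
  evalTerms-tabulate {k = zero}  s g = refl
  evalTerms-tabulate {k = suc k} s g = cong (evalTerm 𝔐 s (g zero) ∷_) (evalTerms-tabulate s (g ∘ suc))

  relFormula-defines : ∀ R → Defines (relFormula R) (relI R)
  relFormula-defines R X =
    (λ X⊨φ s → subst (relI R) (vars s) ∘ X⊨φ s) , (λ X⊆R s → subst (relI R) (sym (vars s)) ∘ X⊆R s)
    where
    vars : ∀ s → evalTerms 𝔐 s (tabulate var) ≡ s
    vars s = trans (evalTerms-tabulate s var) (tabulate∘lookup s)

  graphFormula-defines : ∀ F → Defines (graphFormula F) (Graph 𝔐 F)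
  graphFormula-defines F X = to , from
    where
    k = funAr F
    args : ∀ (v : Vec M k) x → evalTerms 𝔐 (v ∷ʳ x) (tabulate (var ∘ inject₁)) ≡ v
    args v x = trans (evalTerms-tabulate (v ∷ʳ x) (var ∘ inject₁))
                     (trans (tabulate-cong (lookup-∷ʳ-inject₁ v x)) (tabulate∘lookup v))
    holds⇔ : ∀ v x → Iff (holdsAt 𝔐 (fapp F (tabulate (var ∘ inject₁)) ≈ var (fromℕ k)) (v ∷ʳ x))
                         (Graph 𝔐 F (v ∷ʳ x))
    holds⇔ v x rewrite args v x | lookup-∷ʳ-fromℕ v x = Iff-trans (sym , sym) (Iff-sym (Graph-∷ʳ 𝔐 F v x))
    to : 𝔐 ∣ X ⊨ graphFormula F → X ⊆ Graph 𝔐 F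
    to X⊨φ s Xs with initLast s
    ... | v , x , refl = proj₁ (holds⇔ v x) (X⊨φ _ Xs)
    from : X ⊆ Graph 𝔐 F → 𝔐 ∣ X ⊨ graphFormula F
    from X⊆Graph s Xs with initLast s
    ... | v , x , refl = proj₂ (holds⇔ v x) (X⊆Graph _ Xs)

  constFormula-defines : ∀ c → Defines (constFormula c) (ConstRel 𝔐 c)
  constFormula-defines c X = (λ { X⊨φ (_ ∷ []) Xa → cong (_∷ []) (sym (X⊨φ _ Xa)) }) ,
                             (λ { X⊆c (_ ∷ []) Xa → sym (∷-injectiveˡ (X⊆c _ Xa)) })

module _ {σ : Signature} {𝔄 𝔅 : Structure σ} (f : PartialTeamMap 𝔄 𝔅) where
  open PartialTeamMap f
  private
    A = Structure.Carrier 𝔄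

  PreservesAndReflects⊆ : Set₁
  PreservesAndReflects⊆ = ∀ {n} {X Y : Rel A n} (p : dom X) (q : dom Y) → Iff (X ⊆ Y) (app X p ⊆ app Y q)

  module _ (⊆-iff : PreservesAndReflects⊆) where
    private
      module ran = ClClosed ran-closed

    app-full : ∀ n (p : dom (fullRel n)) → app (fullRel n) p ≐ fullRel n
    app-full n p with ran.full∈ n
    ... | Z , z , (_ , full⊆fZ) = (λ _ _ → tt) , λ v _ → proj₁ (⊆-iff z p) (λ _ _ → tt) v (full⊆fZ v tt)

    -- f(X) ∩ f(Y) is some f(Z) because ran is closed under ∩; then Z ⊆ X ∩ Y as ⊆ is reflected.
    app-∩ : ∀ {n} {X Y : Rel A n} (p : dom X) (q : dom Y) (r : dom (X ∩ Y)) →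
            app (X ∩ Y) r ≐ (app X p ∩ app Y q)
    app-∩ {X = X} {Y} p q r = (λ v fXY → fXY⊆fX v fXY , fXY⊆fY v fXY) , fX∩fY⊆fXY
      where
      fXY⊆fX = proj₁ (⊆-iff r p) (λ _ → proj₁)
      fXY⊆fY = proj₁ (⊆-iff r q) (λ _ → proj₂)
      fX∩fY⊆fXY : (app X p ∩ app Y q) ⊆ app (X ∩ Y) r
      fX∩fY⊆fXY with ran.∩∈ (X , p , ≐-refl) (Y , q , ≐-refl)
      ... | Z , z , (fZ⊆fX∩fY , fX∩fY⊆fZ) = λ v → fZ⊆fXY v ∘ fX∩fY⊆fZ v
        where
        Z⊆X = proj₂ (⊆-iff z p) (λ v → proj₁ ∘ fZ⊆fX∩fY v)
        Z⊆Y = proj₂ (⊆-iff z q) (λ v → proj₂ ∘ fZ⊆fX∩fY v)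
        fZ⊆fXY = proj₁ (⊆-iff z r) (λ v Zv → Z⊆X v Zv , Z⊆Y v Zv)

module _ (lem : ∀ {ℓ} → ExcludedMiddle ℓ) {σ : Signature} {𝔄 𝔅 : Structure σ}
         (f : PartialTeamMap 𝔄 𝔅) (iso : IsPartialTeamIso f) where
  open PartialTeamMap f
  open IsPartialTeamIso iso
  private
    module dom = ClClosed dom-closed

  app-⟦⟧ : ∀ {n} (e : ClExpr σ n) → Σ (dom (⟦ e ⟧ 𝔄)) λ p → app (⟦ e ⟧ 𝔄) p ≐ ⟦ e ⟧ 𝔅
  app-⟦⟧ (‵full n)  = dom.full∈ n , app-full f ⊆-iff n _
  app-⟦⟧ ‵diag      = dom.diag∈ , pres-diag _
  app-⟦⟧ (‵rel R)   = dom.rel∈ R , pres-rel R _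
  app-⟦⟧ (‵graph F) = dom.graph∈ F , pres-graph F _
  app-⟦⟧ (‵const c) = dom.const∈ c , pres-const c _
  app-⟦⟧ (e ‵∩ e′) with app-⟦⟧ e | app-⟦⟧ e′
  ... | p , fe≐e | q , fe′≐e′ = dom.∩∈ p q , ≐-trans (app-∩ f ⊆-iff p q _) (∩-cong fe≐e fe′≐e′)
  app-⟦⟧ (e ‵⊗ e′) with app-⟦⟧ e | app-⟦⟧ e′
  ... | p , fe≐e | q , fe′≐e′ = dom.⊗∈ p q , ≐-trans (pres-⊗ p q _) (⊗-cong fe≐e fe′≐e′)
  app-⟦⟧ (‵Pr ı e) with app-⟦⟧ e
  ... | p , fe≐e = dom.Pr∈ ı p , ≐-trans (pres-Pr ı p _) (Pr-cong ı fe≐e)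

  iso⇒preservesQF : PreservesQFFormulas f
  iso⇒preservesQF _ (atom a) {X} p with app-⟦⟧ (‵atom a)
  ... | q , fa≐a =
    Iff-trans (atom-defines 𝔄 a X)
      (Iff-trans (⊆-iff p q)
        (Iff-trans (⊆-resp-≐ ≐-refl fa≐a) (Iff-sym (atom-defines 𝔅 a (app X p)))))
  iso⇒preservesQF _ (incl x y) {X} p =
    Iff-trans (⊨incl⇔Pr⊆Pr 𝔄 x y X)
      (Iff-trans (⊆-iff (dom.Pr∈ x p) (dom.Pr∈ y p))
        (Iff-trans (⊆-resp-≐ (pres-Pr x p _) (pres-Pr y p _)) (Iff-sym (⊨incl⇔Pr⊆Pr 𝔅 x y (app X p)))))
  iso⇒preservesQF _ (dep x) {X} p =
    Iff-trans (⊨dep⇔IsEmpty⊎IsSingleton 𝔄 lem x X)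
      (Iff-trans (Iff-⊎ (Iff-trans (empty-iff r) (IsEmpty-resp-≐ fPr≐Pr))
                        (Iff-trans (singleton-iff r) (IsSingleton-resp-≐ fPr≐Pr)))
        (Iff-sym (⊨dep⇔IsEmpty⊎IsSingleton 𝔅 lem x (app X p))))
    where
    r = dom.Pr∈ x p
    fPr≐Pr = pres-Pr x p r
  iso⇒preservesQF _ (∼ qφ)    p = Iff-⊎ (empty-iff p) (Iff-¬ (iso⇒preservesQF _ qφ p))
  iso⇒preservesQF _ (qφ ∧ qψ) p = Iff-× (iso⇒preservesQF _ qφ p) (iso⇒preservesQF _ qψ p)
  iso⇒preservesQF _ (qφ ∨ qψ) p = Iff-⊎ (iso⇒preservesQF _ qφ p) (iso⇒preservesQF _ qψ p)

module _ (lem : ∀ {ℓ} → ExcludedMiddle ℓ) {σ : Signature} {𝔄 𝔅 : Structure σ}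
         (f : PartialTeamMap 𝔄 𝔅) (pres-⊗ : PreservesProducts f) (pres-QF : PreservesQFFormulas f) where
  open PartialTeamMap f
  private
    module dom = ClClosed dom-closed
    module ran = ClClosed ran-closed
    A = Structure.Carrier 𝔄

  empty-iff : ∀ {n} {X : Rel A n} (p : dom X) → Iff (IsEmpty X) (IsEmpty (app X p))
  empty-iff {X = X} p =
    Iff-trans (Iff-sym (⊨emptiness⇔IsEmpty 𝔄 X))
      (Iff-trans (pres-QF _ (∼ dep []) p) (⊨emptiness⇔IsEmpty 𝔅 _))

  inhabited-iff : ∀ {n} {X : Rel A n} (p : dom X) → Iff (Inhabited X) (Inhabited (app X p))
  inhabited-iff {X = X} p =
    Iff-trans (Inhabited⇔¬IsEmpty lem X)
      (Iff-trans (Iff-¬ (empty-iff p)) (Iff-sym (Inhabited⇔¬IsEmpty lem _)))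

  ⊗-⊨-iff : ∀ {n m} {X : Rel A n} {Y : Rel A m} (φ : Formula σ (n + m)) → QuantifierFree σ φ →
            (p : dom X) (q : dom Y) → Iff (𝔄 ∣ X ⊗ Y ⊨ φ) (𝔅 ∣ app X p ⊗ app Y q ⊨ φ)
  ⊗-⊨-iff φ qφ p q =
    Iff-trans (pres-QF φ qφ r) (⊨-resp-≐ 𝔅 φ fXY≐fX⊗fY , ⊨-resp-≐ 𝔅 φ (≐-sym fXY≐fX⊗fY))
    where
    r = dom.⊗∈ p q
    fXY≐fX⊗fY = pres-⊗ p q r

  ⊆-iff : PreservesAndReflects⊆ f
  ⊆-iff {n} {X} {Y} p q =
    Iff-trans (⊆⇔⊗⊨Pr⊆Formula 𝔄 X Y)
      (Iff-trans (Iff-× (Iff-→ (inhabited-iff p) (inhabited-iff q)) (⊗-⊨-iff _ (incl _ _) p q))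
        (Iff-sym (⊆⇔⊗⊨Pr⊆Formula 𝔅 _ _)))

  Pr≐-iff : ∀ {n m} (ı : Vec (Fin n) m) {X : Rel A n} {Y : Rel A m} (p : dom X) (q : dom Y) →
            Iff (Pr ı X ≐ Y) (Pr ı (app X p) ≐ app Y q)
  Pr≐-iff ı {X} {Y} p q =
    Iff-trans (Pr≐⇔⊗⊨ 𝔄 ı X Y)
      (Iff-trans (Iff-× (Iff-× (Iff-→ (inhabited-iff p) (inhabited-iff q)) (⊗-⊨-iff _ (incl _ _) p q))
                        (Iff-× (Iff-→ (inhabited-iff q) (inhabited-iff p)) (⊗-⊨-iff _ (incl _ _) p q)))
        (Iff-sym (Pr≐⇔⊗⊨ 𝔅 ı _ _)))

  pres-Pr : ∀ {n m} (ı : Vec (Fin n) m) {X : Rel A n} (p : dom X) (r : dom (Pr ı X)) →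
            app (Pr ı X) r ≐ Pr ı (app X p)
  pres-Pr ı p r = ≐-sym (proj₁ (Pr≐-iff ı p r) ≐-refl)

  singleton-iff : ∀ {n} {X : Rel A n} (p : dom X) → Iff (IsSingleton X) (IsSingleton (app X p))
  singleton-iff {X = X} p =
    Iff-trans (IsSingleton⇔Inhabited×⊨constancy 𝔄 X)
      (Iff-trans (Iff-× (inhabited-iff p) (pres-QF _ (dep _) p))
        (Iff-sym (IsSingleton⇔Inhabited×⊨constancy 𝔅 _)))

  full-iff : ∀ {n} {X : Rel A n} (p : dom X) → Iff (IsFull X) (IsFull (app X p))
  full-iff {n} {X} p =
    Iff-trans (IsFull⇔full⊆ X)
      (Iff-trans (⊆-iff (dom.full∈ n) p)
        (Iff-trans (⊆-resp-≐ (app-full f ⊆-iff n _) ≐-refl) (Iff-sym (IsFull⇔full⊆ _))))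

  app-defined : ∀ {n} (φ : Formula σ n) → QuantifierFree σ φ →
                {R : (𝔐 : Structure σ) → Rel (Structure.Carrier 𝔐) n} → (∀ 𝔐 → Defines 𝔐 φ (R 𝔐)) →
                ran (R 𝔅) → (d : dom (R 𝔄)) → app (R 𝔄) d ≐ R 𝔅
  app-defined φ qφ {R} φ-defines (Z , z , fZ≐R𝔅) d = fR⊆R𝔅 , R𝔅⊆fR
    where
    fR⊆R𝔅 : app (R 𝔄) d ⊆ R 𝔅
    fR⊆R𝔅 = proj₁ (φ-defines 𝔅 _) (proj₁ (pres-QF φ qφ d) (proj₂ (φ-defines 𝔄 (R 𝔄)) λ _ → id))
    Z⊆R : Z ⊆ R 𝔄
    Z⊆R = proj₁ (φ-defines 𝔄 Z) (proj₂ (pres-QF φ qφ z) (proj₂ (φ-defines 𝔅 _) (proj₁ fZ≐R𝔅)))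
    R𝔅⊆fR : R 𝔅 ⊆ app (R 𝔄) d
    R𝔅⊆fR v Rv = proj₁ (⊆-iff z d) Z⊆R v (proj₂ fZ≐R𝔅 v Rv)

  preservesQF⇒iso : IsPartialTeamIso f
  preservesQF⇒iso = record
    { empty-iff     = empty-iff
    ; full-iff      = full-iff
    ; singleton-iff = singleton-iff
    ; pres-⊗        = pres-⊗
    ; pres-Pr       = pres-Pr
    ; ⊆-iff         = ⊆-iff
    ; pres-diag     = app-defined diagFormula (atom _) diagFormula-defines ran.diag∈
    ; pres-rel      = λ R → app-defined (relFormula R) (atom _) (λ 𝔐 → relFormula-defines 𝔐 R) (ran.rel∈ R)
    ; pres-graph    = λ F → app-defined (graphFormula F) (atom _) (λ 𝔐 → graphFormula-defines 𝔐 F) (ran.graph∈ F)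
    ; pres-const    = λ c → app-defined (constFormula c) (atom _) (λ 𝔐 → constFormula-defines 𝔐 c) (ran.const∈ c)
    }

mainTheorem10 : (lem : ∀ {ℓ} → ExcludedMiddle ℓ) →
    ∀ {σ : Signature} {𝔄 𝔅 : Structure σ} (f : PartialTeamMap 𝔄 𝔅) →
      Iff (IsPartialTeamIso f) (PreservesProducts f × PreservesQFFormulas f)
      × (IsPartialElementaryTeamMap f → IsPartialTeamIso f)
mainTheorem10 lem f =
  ( (λ iso → IsPartialTeamIso.pres-⊗ iso , iso⇒preservesQF lem f iso)
  , (λ (pres-⊗ , pres-QF) → preservesQF⇒iso lem f pres-⊗ pres-QF) )
  , λ (pres-⊗ , pres-all) → preservesQF⇒iso lem f pres-⊗ (λ φ _ → pres-all φ)
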